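{- Let $G$ and $H$ be connected graphs of orders $n_1\ge 2$ and $n_2\ge 2$ respectively. Then for every integer $k\ge 1$, $$Z(G\odot^{k}H)=Z(G\odot^{k-1}H)+n_1(n_2+1)^{k-1}Z(H),$$ where $G\odot^{0}H:=G$. In particular, $Z(G\odot H)=Z(G)+n_1Z(H)$.
   Context: All graphs are finite, simple and undirected. Zero forcing: given a set $S$ of initially black vertices of a graph (all others white), the color-change rule turns a white vertex $w$ black if $w$ is the only white neighbor of some black vertex. $S$ is a zero forcing set if repeated application of this rule eventually turns all vertices black; $Z(G)$, the zero forcing number, is the minimum size of a zero forcing set of $G$. Corona product: for graphs $G$ of order $n_1$ and $H$, $G\odot H$ is obtained from one copy of $G$ and $n_1$ disjoint copies of $H$ by joining the $i$-th vertex of $G$ by an edge to every vertex of the $i$-th copy of $H$. For $k\ge 2$, $G\odot^{k}H=(G\odot^{k-1}H)\odot H$, with $G\odot^1 H=G\odot H$. -}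

module Defs where

open import Data.Nat using (ℕ; zero; suc; _+_; _*_; _≤_)
open import Data.Bool using (Bool; true; false; _∧_; T)
open import Data.Fin using (Fin; splitAt; quotRem; _≟_)
open import Data.Fin.Subset using (Subset; _∈_; _∉_; ⁅_⁆; _∪_; ∣_∣)
open import Data.Product using (_×_; _,_)
open import Data.Sum using (inj₁; inj₂)
open import Relation.Binary.PropositionalEquality using (_≡_; _≢_)
open import Relation.Nullary using (¬_)
open import Relation.Nullary.Decidable using (⌊_⌋)

RawGraph : ℕ → Set
RawGraph n = Fin n → Fin n → Bool

Adj : ∀ {n} → RawGraph n → Fin n → Fin n → Set
Adj g u v = T (g u v)

record IsSimple {n} (g : RawGraph n) : Set where
  field
    symmetric   : ∀ u v → g u v ≡ g v u
    irreflexive : ∀ u → ¬ Adj g u u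

data Reachable {n} (g : RawGraph n) : Fin n → Fin n → Set where
  here : ∀ {u} → Reachable g u u
  there : ∀ {u v w} → Adj g u v → Reachable g v w → Reachable g u w

Connected : ∀ {n} → RawGraph n → Set
Connected {n} g = ∀ (u v : Fin n) → Reachable g u v

data Forces {n} (g : RawGraph n) : Subset n → Set where
  done : ∀ {B} → (∀ v → v ∈ B) → Forces g B
  step : ∀ {B} (u w : Fin n) → u ∈ B → w ∉ B → Adj g u w →
         (∀ x → Adj g u x → x ≢ w → x ∈ B) →
         Forces g (B ∪ ⁅ w ⁆) → Forces g B

IsZeroForcingSet : ∀ {n} → RawGraph n → Subset n → Set
IsZeroForcingSet g S = Forces g S

IsZeroForcingNumber : ∀ {n} → RawGraph n → ℕ → Set
IsZeroForcingNumber {n} g z =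
  (Data.Product.Σ (Subset n) λ S → IsZeroForcingSet g S × ∣ S ∣ ≡ z) ×
  (∀ (S : Subset n) → IsZeroForcingSet g S → z ≤ ∣ S ∣)

-- Vertices: Fin (n₁ + n₁ * n₂); the first n₁ are the vertices of G, a vertex
-- in the second block decodes via quotRem to (vertex of H, copy index i).
corona : ∀ {n₁ n₂} → RawGraph n₁ → RawGraph n₂ → RawGraph (n₁ + n₁ * n₂)
corona {n₁} {n₂} g h u v with splitAt n₁ u | splitAt n₁ v
... | inj₁ i | inj₁ j = g i j
... | inj₁ i | inj₂ q with quotRem {n₁} n₂ q
...   | (_ , c) = ⌊ i ≟ c ⌋
corona {n₁} {n₂} g h u v | inj₂ p | inj₁ j with quotRem {n₁} n₂ p
...   | (_ , c) = ⌊ j ≟ c ⌋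
corona {n₁} {n₂} g h u v | inj₂ p | inj₂ q with quotRem {n₁} n₂ p | quotRem {n₁} n₂ q
...   | (a , c) | (b , d) = ⌊ c ≟ d ⌋ ∧ h a b

coronaOrder : ℕ → ℕ → ℕ → ℕ
coronaOrder n₁ n₂ zero = n₁
coronaOrder n₁ n₂ (suc k) = coronaOrder n₁ n₂ k + coronaOrder n₁ n₂ k * n₂

coronaPow : ∀ {n₁ n₂} (k : ℕ) → RawGraph n₁ → RawGraph n₂ → RawGraph (coronaOrder n₁ n₂ k)
coronaPow zero g h = g
coronaPow (suc k) g h = corona (coronaPow k g h) h

-- Upper bound: a zero forcing set of G together with a zero forcing set of H in every copy
-- forces G ⊙ H.  Before a vertex of G forces, its copy of H is filled by replaying H's
-- forcing chain there (its only outside neighbour is already black); afterwards the copy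
-- no longer obstructs forces inside G.
--
-- Lower bound: read a forcing chain of G ⊙ H backwards, from the all-black set to the
-- initial set B, and maintain a zero forcing set X of G containing the black vertices of G
-- such that every copy i of H carries at least Z(H) + [i ∈ X] vertices of B, counting the
-- vertex i of G itself.  A force between vertices of G removes the forced vertex from X.
-- A force from copy i into the vertex i of G happens only when the forcing vertex a has
-- its whole H-neighbourhood black; then a can itself force a neighbour, so a zero forcing
-- set of H smaller than B's part of copy i exists.  Summing, |B| ≥ |X| + n Z(H) ≥ Z(G) + n Z(H).

module Submission where

open import Defs
open import Data.Nat using (ℕ; zero; suc; _+_; _*_; _^_; _∸_; _≤_; _<_; z≤n; s≤s)
open import Data.Nat.Properties
  using (≤-refl; ≤-trans; ≤-antisym; +-mono-≤; +-monoˡ-≤; +-assoc; *-identityʳ;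
         +-0-commutativeMonoid; module ≤-Reasoning)
open import Data.Nat.Tactic.RingSolver using (solve-∀)
open import Data.Bool using (Bool; true; false; T; _∧_)
open import Data.Bool.Properties using (T-∧)
open import Data.Fin using (Fin; zero; suc; _↑ˡ_; _↑ʳ_; combine; splitAt; join; quotRem; _≟_)
open import Data.Fin.Properties
  using (join-splitAt; combine-remQuot; remQuot-combine; splitAt-↑ˡ; splitAt-↑ʳ;
         ↑ˡ-injective; ↑ʳ-injective; combine-injective)
open import Data.Fin.Subset using (Subset; _∈_; _∉_; ⁅_⁆; _∪_; _-_; _⊆_; ∣_∣; ⊤)
open import Data.Fin.Subset.Properties
  using (_∈?_; x∈p∪q⁻; x∈p∪q⁺; x∈⁅x⁆; x∈⁅y⁆⇒x≡y; x∈p∧x≢y⇒x∈p-y; ∈⊤; ⊆-antisym; p─q⊆p;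
         x∈p⇒∣p-x∣<∣p∣)
open import Data.List using (List; []; _∷_; allFin)
open import Data.List.Membership.Propositional using () renaming (_∈_ to _∈ₗ_)
open import Data.List.Membership.Propositional.Properties using (∈-allFin)
open import Data.List.Relation.Unary.Any using (here; there)
open import Data.Vec using ([]; _∷_; lookup; tabulate)
open import Data.Vec.Properties
  using ([]=⇒lookup; lookup⇒[]=; lookup∘tabulate; tabulate-cong; tabulate∘lookup)
import Data.Vec.Base as Vec
open import Data.Product using (_×_; _,_; proj₁; proj₂; swap; map₁; ∃-syntax)
open import Data.Sum using (_⊎_; inj₁; inj₂; [_,_]′; map₂)
open import Relation.Binary.PropositionalEquality
open import Data.Empty using (⊥-elim)
open import Relation.Nullary using (¬_; yes; no; contradiction)
open import Relation.Nullary.Decidable using (⌊_⌋; toWitness; fromWitness)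
open import Function.Bundles using (Equivalence)
open import Function using (_∘_; id)
open import Algebra.Properties.CommutativeMonoid.Sum +-0-commutativeMonoid
  using (sum; sum-syntax; sum-cong-≗; ∑-distrib-+)

module _ {k} {p : Subset k} {x y : Fin k} where

  x∈p∪⁅y⁆⇒x∈p⊎x≡y : x ∈ p ∪ ⁅ y ⁆ → x ∈ p ⊎ x ≡ y
  x∈p∪⁅y⁆⇒x∈p⊎x≡y x∈ = map₂ (x∈⁅y⁆⇒x≡y y) (x∈p∪q⁻ p ⁅ y ⁆ x∈)

  x∈p⇒x∈p∪⁅y⁆ : x ∈ p → x ∈ p ∪ ⁅ y ⁆
  x∈p⇒x∈p∪⁅y⁆ x∈p = x∈p∪q⁺ (inj₁ x∈p)

y∈p∪⁅y⁆ : ∀ {k} {p : Subset k} {y} → y ∈ p ∪ ⁅ y ⁆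
y∈p∪⁅y⁆ {y = y} = x∈p∪q⁺ (inj₂ (x∈⁅x⁆ y))

p⊆q∧y∈q⇒p∪⁅y⁆⊆q : ∀ {k} {p q : Subset k} {y} → p ⊆ q → y ∈ q → p ∪ ⁅ y ⁆ ⊆ q
p⊆q∧y∈q⇒p∪⁅y⁆⊆q p⊆q y∈q x∈ with x∈p∪⁅y⁆⇒x∈p⊎x≡y x∈
... | inj₁ x∈p  = p⊆q x∈p
... | inj₂ refl = y∈q

x∉p-x : ∀ {k} (p : Subset k) x → x ∉ p - x
x∉p-x (_ ∷ p) (suc x) (Vec.there x∈) = x∉p-x p x x∈

p⊆p-x∪⁅x⁆ : ∀ {k} {p : Subset k} {x} → p ⊆ (p - x) ∪ ⁅ x ⁆
p⊆p-x∪⁅x⁆ {x = x} {y} y∈p with y ≟ x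
... | yes refl = y∈p∪⁅y⁆
... | no y≢x   = x∈p⇒x∈p∪⁅y⁆ (x∈p∧x≢y⇒x∈p-y y∈p y≢x)

all-but-y⇒x∈p∪⁅y⁆ : ∀ {k} {p : Subset k} {y} → (∀ x → x ≢ y → x ∈ p) → ∀ x → x ∈ p ∪ ⁅ y ⁆
all-but-y⇒x∈p∪⁅y⁆ {y = y} p∋others x with x ≟ y
... | yes refl = y∈p∪⁅y⁆
... | no  x≢y  = x∈p⇒x∈p∪⁅y⁆ (p∋others x x≢y)

opaque
  preimage : ∀ {a b} → (Fin a → Fin b) → Subset b → Subset a
  preimage f B = tabulate (lookup B ∘ f)

  lookup-preimage : ∀ {a b} (f : Fin a → Fin b) B x → lookup (preimage f B) x ≡ lookup B (f x)
  lookup-preimage f B = lookup∘tabulate (lookup B ∘ f)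

module _ {a b} {f : Fin a → Fin b} {B : Subset b} where

  ∈-preimage⁺ : ∀ {x} → f x ∈ B → x ∈ preimage f B
  ∈-preimage⁺ {x} fx∈B = lookup⇒[]= x _ (trans (lookup-preimage f B x) ([]=⇒lookup fx∈B))

  ∈-preimage⁻ : ∀ {x} → x ∈ preimage f B → f x ∈ B
  ∈-preimage⁻ {x} x∈ = lookup⇒[]= (f x) B (trans (sym (lookup-preimage f B x)) ([]=⇒lookup x∈))

preimage-⊆ : ∀ {a b} {f : Fin a → Fin b} {B B′} → B ⊆ B′ → preimage f B ⊆ preimage f B′
preimage-⊆ B⊆B′ = ∈-preimage⁺ ∘ B⊆B′ ∘ ∈-preimage⁻

preimage-∪⁅⁆ : ∀ {a b} {f : Fin a → Fin b} {B y} → (∀ x → f x ≢ y) → preimage f (B ∪ ⁅ y ⁆) ≡ preimage f B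
preimage-∪⁅⁆ {f = f} {B} {y} f≢y = ⊆-antisym (∈-preimage⁺ ∘ fx∈B ∘ x∈p∪⁅y⁆⇒x∈p⊎x≡y ∘ ∈-preimage⁻)
                                     (preimage-⊆ x∈p⇒x∈p∪⁅y⁆)
  where
  fx∈B : ∀ {x} → f x ∈ B ⊎ f x ≡ y → f x ∈ B
  fx∈B (inj₁ fx∈B) = fx∈B
  fx∈B (inj₂ fx≡y) = ⊥-elim (f≢y _ fx≡y)

preimage-∪⁅f⁆ : ∀ {a b} {f : Fin a → Fin b} {B y} → (∀ {x} → f x ≡ f y → x ≡ y) →
                preimage f (B ∪ ⁅ f y ⁆) ⊆ preimage f B ∪ ⁅ y ⁆
preimage-∪⁅f⁆ {f = f} f-inj {x} x∈ with x∈p∪⁅y⁆⇒x∈p⊎x≡y (∈-preimage⁻ x∈)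
... | inj₁ fx∈B  = x∈p⇒x∈p∪⁅y⁆ (∈-preimage⁺ fx∈B)
... | inj₂ fx≡fy with refl ← f-inj {x} fx≡fy = y∈p∪⁅y⁆

lookup-ext : ∀ {k} {p q : Subset k} → (∀ x → lookup p x ≡ lookup q x) → p ≡ q
lookup-ext {p = p} {q} p≗q = trans (sym (tabulate∘lookup p)) (trans (tabulate-cong p≗q) (tabulate∘lookup q))

-- Zero forcing

record CanForce {k} (g : RawGraph k) (B : Subset k) (u w : Fin k) : Set where
  constructor canForce
  field
    black       : u ∈ B
    white       : w ∉ B
    adjacent    : Adj g u w
    othersBlack : ∀ x → Adj g u x → x ≢ w → x ∈ B

Forces-⊆ : ∀ {k} {g : RawGraph k} {B B′} → B ⊆ B′ → Forces g B → Forces g B′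
Forces-⊆ B⊆B′ (done all) = done (λ v → B⊆B′ (all v))
Forces-⊆ {B′ = B′} B⊆B′ (step u w u∈B w∉B uw others F) with w ∈? B′
... | yes w∈B′ = Forces-⊆ (p⊆q∧y∈q⇒p∪⁅y⁆⊆q B⊆B′ w∈B′) F
... | no  w∉B′ = step u w (B⊆B′ u∈B) w∉B′ uw (λ x ux x≢w → B⊆B′ (others x ux x≢w))
                   (Forces-⊆ (p⊆q∧y∈q⇒p∪⁅y⁆⊆q (x∈p⇒x∈p∪⁅y⁆ ∘ B⊆B′) y∈p∪⁅y⁆) F)

Forces-all-but-one : ∀ {k} {h : RawGraph k} {S z w} → (∀ x → x ≢ w → x ∈ S) →
                     Adj h z w → z ≢ w → Forces h S
Forces-all-but-one {S = S} {z} {w} S∋others zw z≢w with w ∈? S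
... | yes w∈S = done (p⊆q∧y∈q⇒p∪⁅y⁆⊆q (λ x∈S → x∈S) w∈S ∘ all-but-y⇒x∈p∪⁅y⁆ S∋others)
... | no  w∉S = step z w (S∋others z z≢w) w∉S zw (λ x _ → S∋others x) (done (all-but-y⇒x∈p∪⁅y⁆ S∋others))

Forces-drop-neighbour : ∀ {k} {h : RawGraph k} {S u z} → ¬ Adj h u u → u ∈ S → Adj h u z →
                        (∀ x → Adj h u x → x ∈ S) → Forces h S → Forces h (S - z)
Forces-drop-neighbour {S = S} {u} {z} ¬uu u∈S uz N[u]⊆S F =
  step u z (x∈p∧x≢y⇒x∈p-y u∈S u≢z) (x∉p-x S z) uz
    (λ x ux x≢z → x∈p∧x≢y⇒x∈p-y (N[u]⊆S x ux) x≢z)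
    (Forces-⊆ p⊆p-x∪⁅x⁆ F)
  where
  u≢z : u ≢ z
  u≢z refl = ¬uu uz

-- Finite sums

indicator : Bool → ℕ
indicator true  = 1
indicator false = 0

∣p∣≡∑ : ∀ {k} (p : Subset k) → ∣ p ∣ ≡ ∑[ x < k ] indicator (lookup p x)
∣p∣≡∑ []          = refl
∣p∣≡∑ (true ∷ p)  = cong suc (∣p∣≡∑ p)
∣p∣≡∑ (false ∷ p) = ∣p∣≡∑ p

∣preimage∣≡∑ : ∀ {a b} (f : Fin a → Fin b) B → ∣ preimage f B ∣ ≡ ∑[ x < a ] indicator (lookup B (f x))
∣preimage∣≡∑ f B = trans (∣p∣≡∑ (preimage f B)) (sum-cong-≗ (cong indicator ∘ lookup-preimage f B))

indicator≤1 : ∀ b → indicator b ≤ 1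
indicator≤1 true  = s≤s z≤n
indicator≤1 false = z≤n

∑-const : ∀ k c → ∑[ i < k ] c ≡ k * c
∑-const zero    c = refl
∑-const (suc k) c = cong (c +_) (∑-const k c)

∑-mono-≤ : ∀ {k} {f f′ : Fin k → ℕ} → (∀ i → f i ≤ f′ i) → sum f ≤ sum f′
∑-mono-≤ {zero}  f≤f′ = ≤-refl
∑-mono-≤ {suc k} f≤f′ = +-mono-≤ (f≤f′ zero) (∑-mono-≤ (f≤f′ ∘ suc))

∑-++ : ∀ a {b} (f : Fin (a + b) → ℕ) →
       sum f ≡ ∑[ i < a ] f (i ↑ˡ b) + ∑[ j < b ] f (a ↑ʳ j)
∑-++ zero    f = refl
∑-++ (suc a) f = trans (cong (f zero +_) (∑-++ a (f ∘ suc))) (sym (+-assoc (f zero) _ _))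

∑-combine : ∀ a {b} (f : Fin (a * b) → ℕ) →
            sum f ≡ ∑[ i < a ] ∑[ j < b ] f (combine i j)
∑-combine zero    f = refl
∑-combine (suc a) {b} f =
  trans (∑-++ b f) (cong (∑[ j < b ] f (j ↑ˡ (a * b)) +_) (∑-combine a (f ∘ (b ↑ʳ_))))

-- The corona product

module Corona {n m} (g : RawGraph n) (h : RawGraph m) where

  g⊙h : RawGraph (n + n * m)
  g⊙h = corona g h

  base : Fin n → Fin (n + n * m)
  base i = i ↑ˡ (n * m)

  copy : Fin n → Fin m → Fin (n + n * m)
  copy i a = n ↑ʳ combine i a

  data Vertex : Fin (n + n * m) → Set where
    inBase : ∀ i → Vertex (base i)
    inCopy : ∀ i a → Vertex (copy i a)

  vertex : ∀ x → Vertex x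
  vertex x = subst Vertex (join-splitAt n (n * m) x) (fromSplit (splitAt n x))
    where
    fromSplit : ∀ s → Vertex (join n (n * m) s)
    fromSplit (inj₁ i) = inBase i
    fromSplit (inj₂ q) = subst (Vertex ∘ (n ↑ʳ_)) (combine-remQuot {n} m q) (inCopy _ _)

  base-injective : ∀ {i j} → base i ≡ base j → i ≡ j
  base-injective = ↑ˡ-injective (n * m) _ _

  copy-injective : ∀ {i j a b} → copy i a ≡ copy j b → i ≡ j × a ≡ b
  copy-injective = combine-injective _ _ _ _ ∘ ↑ʳ-injective n _ _

  base≢copy : ∀ {i j a} → base i ≢ copy j a
  base≢copy {i} {j} {a} eq with
    trans (sym (splitAt-↑ˡ n i (n * m))) (trans (cong (splitAt n) eq) (splitAt-↑ʳ n (n * m) (combine j a)))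
  ... | ()

  private
    quotRem-combine : ∀ i a → quotRem {n} m (combine i a) ≡ (a , i)
    quotRem-combine i a = cong swap (remQuot-combine i a)

    base-base : ∀ i j → g⊙h (base i) (base j) ≡ g i j
    base-base i j rewrite splitAt-↑ˡ n i (n * m) | splitAt-↑ˡ n j (n * m) = refl

    base-copy : ∀ i j a → g⊙h (base i) (copy j a) ≡ ⌊ i ≟ j ⌋
    base-copy i j a
      rewrite splitAt-↑ˡ n i (n * m) | splitAt-↑ʳ n (n * m) (combine j a) | quotRem-combine j a = refl

    copy-base : ∀ i j a → g⊙h (copy j a) (base i) ≡ ⌊ i ≟ j ⌋
    copy-base i j a
      rewrite splitAt-↑ˡ n i (n * m) | splitAt-↑ʳ n (n * m) (combine j a) | quotRem-combine j a = refl

    copy-copy : ∀ i a j b → g⊙h (copy i a) (copy j b) ≡ ⌊ i ≟ j ⌋ ∧ h a b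
    copy-copy i a j b
      rewrite splitAt-↑ʳ n (n * m) (combine i a) | splitAt-↑ʳ n (n * m) (combine j b)
            | quotRem-combine i a | quotRem-combine j b = refl

  adj-base-base⁻ : ∀ {i j} → Adj g⊙h (base i) (base j) → Adj g i j
  adj-base-base⁻ {i} {j} = subst T (base-base i j)

  adj-base-base⁺ : ∀ {i j} → Adj g i j → Adj g⊙h (base i) (base j)
  adj-base-base⁺ {i} {j} = subst T (sym (base-base i j))

  adj-base-copy⁻ : ∀ {i j a} → Adj g⊙h (base i) (copy j a) → i ≡ j
  adj-base-copy⁻ {i} {j} {a} = toWitness ∘ subst T (base-copy i j a)

  adj-base-copy⁺ : ∀ {i a} → Adj g⊙h (base i) (copy i a)
  adj-base-copy⁺ {i} {a} = subst T (sym (base-copy i i a)) (fromWitness refl)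

  adj-copy-base⁻ : ∀ {i j a} → Adj g⊙h (copy j a) (base i) → i ≡ j
  adj-copy-base⁻ {i} {j} {a} = toWitness ∘ subst T (copy-base i j a)

  adj-copy-base⁺ : ∀ {i a} → Adj g⊙h (copy i a) (base i)
  adj-copy-base⁺ {i} {a} = subst T (sym (copy-base i i a)) (fromWitness refl)

  adj-copy-copy⁻ : ∀ {i a j b} → Adj g⊙h (copy i a) (copy j b) → i ≡ j × Adj h a b
  adj-copy-copy⁻ {i} {a} {j} {b} ab =
    map₁ toWitness (Equivalence.to T-∧ (subst T (copy-copy i a j b) ab))

  adj-copy-copy⁺ : ∀ {i a b} → Adj h a b → Adj g⊙h (copy i a) (copy i b)
  adj-copy-copy⁺ {i} {a} {b} ab =
    subst T (sym (copy-copy i a i b)) (Equivalence.from T-∧ (fromWitness refl , ab))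

  fillCopy : ∀ i {Y} → Forces h Y → ∀ {B} → base i ∈ B → Y ⊆ preimage (copy i) B →
             (∀ {B′} → B ⊆ B′ → (∀ a → copy i a ∈ B′) → Forces g⊙h B′) → Forces g⊙h B
  fillCopy i (done Y∋all) i∈B Y⊆ fill = fill (λ x∈ → x∈) (∈-preimage⁻ ∘ Y⊆ ∘ Y∋all)
  fillCopy i (step u w u∈Y w∉Y uw others F) {B} i∈B Y⊆ fill with copy i w ∈? B
  ... | yes w∈B = fillCopy i F i∈B (p⊆q∧y∈q⇒p∪⁅y⁆⊆q Y⊆ (∈-preimage⁺ w∈B)) fill
  ... | no  w∉B = step (copy i u) (copy i w) (∈-preimage⁻ (Y⊆ u∈Y)) w∉B (adj-copy-copy⁺ uw) others′
                    (fillCopy i F (x∈p⇒x∈p∪⁅y⁆ i∈B)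
                      (p⊆q∧y∈q⇒p∪⁅y⁆⊆q (preimage-⊆ B⊆B∪⁅w⁆ ∘ Y⊆) (∈-preimage⁺ {f = copy i} (y∈p∪⁅y⁆ {p = B})))
                      (λ B∪⊆B′ → fill (B∪⊆B′ ∘ B⊆B∪⁅w⁆)))
    where
    B⊆B∪⁅w⁆ : B ⊆ B ∪ ⁅ copy i w ⁆
    B⊆B∪⁅w⁆ = x∈p⇒x∈p∪⁅y⁆
    others′ : ∀ x → Adj g⊙h (copy i u) x → x ≢ copy i w → x ∈ B
    others′ x ux x≢w with vertex x
    ... | inBase j with refl ← adj-copy-base⁻ ux = i∈B
    ... | inCopy j b with (refl , ub) ← adj-copy-copy⁻ ux =
      ∈-preimage⁻ (Y⊆ (others b ub (λ { refl → x≢w refl })))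

  -- l lists the copies that may still contain white vertices.
  fillCopies : ∀ (l : List (Fin n)) {B} → (∀ i → base i ∈ B) → (∀ i → Forces h (preimage (copy i) B)) →
               (∀ i a → i ∈ₗ l ⊎ copy i a ∈ B) → Forces g⊙h B
  fillCopies [] {B} bases _ full = done B∋all
    where
    B∋all : ∀ x → x ∈ B
    B∋all x with vertex x
    ... | inBase i = bases i
    ... | inCopy i a with full i a
    ...   | inj₂ x∈B = x∈B
  fillCopies (i ∷ l) {B} bases Fs full = fillCopy i (Fs i) (bases i) (λ a∈ → a∈) fill
    where
    fill : ∀ {B′} → B ⊆ B′ → (∀ a → copy i a ∈ B′) → Forces g⊙h B′
    fill {B′} B⊆B′ i-full = fillCopies l (B⊆B′ ∘ bases) (λ j → Forces-⊆ (preimage-⊆ B⊆B′) (Fs j)) full′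
      where
      full′ : ∀ j a → j ∈ₗ l ⊎ copy j a ∈ B′
      full′ j a with full j a
      ... | inj₁ (here refl) = inj₂ (i-full a)
      ... | inj₁ (there j∈l) = inj₁ j∈l
      ... | inj₂ x∈B = inj₂ (B⊆B′ x∈B)

  Forces-lift : ∀ {X} → Forces g X → ∀ {B} → X ⊆ preimage base B →
                (∀ i → Forces h (preimage (copy i) B)) → Forces g⊙h B
  Forces-lift (done X∋all) X⊆ Fs =
    fillCopies (allFin n) (∈-preimage⁻ ∘ X⊆ ∘ X∋all) Fs (λ i _ → inj₁ (∈-allFin i))
  Forces-lift (step u w u∈X w∉X uw others F) {B} X⊆ Fs =
    fillCopy u (Fs u) (∈-preimage⁻ (X⊆ u∈X)) (λ a∈ → a∈) fill
    where
    fill : ∀ {B′} → B ⊆ B′ → (∀ a → copy u a ∈ B′) → Forces g⊙h B′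
    fill {B′} B⊆B′ u-full with base w ∈? B′
    ... | yes w∈B′ =
      Forces-lift F (p⊆q∧y∈q⇒p∪⁅y⁆⊆q (preimage-⊆ B⊆B′ ∘ X⊆) (∈-preimage⁺ w∈B′))
                    (Forces-⊆ (preimage-⊆ B⊆B′) ∘ Fs)
    ... | no  w∉B′ =
      step (base u) (base w) (B⊆B′ (∈-preimage⁻ (X⊆ u∈X))) w∉B′ (adj-base-base⁺ uw) others′
        (Forces-lift F (p⊆q∧y∈q⇒p∪⁅y⁆⊆q (preimage-⊆ B⊆B′∪⁅w⁆ ∘ X⊆) (∈-preimage⁺ {f = base} (y∈p∪⁅y⁆ {p = B′})))
                       (Forces-⊆ (preimage-⊆ B⊆B′∪⁅w⁆) ∘ Fs))
      where
      B⊆B′∪⁅w⁆ : B ⊆ B′ ∪ ⁅ base w ⁆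
      B⊆B′∪⁅w⁆ = x∈p⇒x∈p∪⁅y⁆ ∘ B⊆B′
      others′ : ∀ x → Adj g⊙h (base u) x → x ≢ base w → x ∈ B′
      others′ x ux x≢w with vertex x
      ... | inBase j = B⊆B′ (∈-preimage⁻ (X⊆ (others j (adj-base-base⁻ ux) (λ { refl → x≢w refl }))))
      ... | inCopy j a with refl ← adj-base-copy⁻ ux = u-full a

  ∣B∣≡∣base∣+∑∣copy∣ : ∀ B → ∣ B ∣ ≡ ∣ preimage base B ∣ + ∑[ i < n ] ∣ preimage (copy i) B ∣
  ∣B∣≡∣base∣+∑∣copy∣ B = begin
    ∣ B ∣
      ≡⟨ ∣p∣≡∑ B ⟩
    ∑[ x < n + n * m ] χ x
      ≡⟨ ∑-++ n χ ⟩
    ∑[ i < n ] χ (base i) + ∑[ q < n * m ] χ (n ↑ʳ q)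
      ≡⟨ cong₂ _+_ (sym (∣preimage∣≡∑ base B)) (∑-combine n (χ ∘ (n ↑ʳ_))) ⟩
    ∣ preimage base B ∣ + ∑[ i < n ] ∑[ a < m ] χ (copy i a)
      ≡⟨ cong (∣ preimage base B ∣ +_) (sum-cong-≗ (λ i → sym (∣preimage∣≡∑ (copy i) B))) ⟩
    ∣ preimage base B ∣ + ∑[ i < n ] ∣ preimage (copy i) B ∣ ∎
    where
    open ≡-Reasoning
    χ : Fin (n + n * m) → ℕ
    χ = indicator ∘ lookup B

  private
    coronaMember : Subset n → Subset m → Fin (n + n * m) → Bool
    coronaMember SG SH x = [ lookup SG , lookup SH ∘ proj₁ ∘ quotRem {n} m ]′ (splitAt n x)

  coronaSet : Subset n → Subset m → Subset (n + n * m)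
  coronaSet SG SH = tabulate (coronaMember SG SH)

  preimage-base-coronaSet : ∀ SG SH → preimage base (coronaSet SG SH) ≡ SG
  preimage-base-coronaSet SG SH = lookup-ext (λ i → trans (lookup-preimage base _ i) (lookup-base i))
    where
    lookup-base : ∀ i → lookup (coronaSet SG SH) (base i) ≡ lookup SG i
    lookup-base i rewrite lookup∘tabulate (coronaMember SG SH) (base i) | splitAt-↑ˡ n i (n * m) = refl

  preimage-copy-coronaSet : ∀ SG SH i → preimage (copy i) (coronaSet SG SH) ≡ SH
  preimage-copy-coronaSet SG SH i = lookup-ext (λ a → trans (lookup-preimage (copy i) _ a) (lookup-copy a))
    where
    lookup-copy : ∀ a → lookup (coronaSet SG SH) (copy i a) ≡ lookup SH a
    lookup-copy a rewrite lookup∘tabulate (coronaMember SG SH) (copy i a)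
                        | splitAt-↑ʳ n (n * m) (combine i a) | quotRem-combine i a = refl

  ∣coronaSet∣ : ∀ SG SH → ∣ coronaSet SG SH ∣ ≡ ∣ SG ∣ + n * ∣ SH ∣
  ∣coronaSet∣ SG SH = begin
    ∣ coronaSet SG SH ∣
      ≡⟨ ∣B∣≡∣base∣+∑∣copy∣ (coronaSet SG SH) ⟩
    ∣ preimage base (coronaSet SG SH) ∣ + ∑[ i < n ] ∣ preimage (copy i) (coronaSet SG SH) ∣
      ≡⟨ cong₂ _+_ (cong ∣_∣ (preimage-base-coronaSet SG SH))
                   (sum-cong-≗ (cong ∣_∣ ∘ preimage-copy-coronaSet SG SH)) ⟩
    ∣ SG ∣ + ∑[ i < n ] ∣ SH ∣
      ≡⟨ cong (∣ SG ∣ +_) (∑-const n ∣ SH ∣) ⟩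
    ∣ SG ∣ + n * ∣ SH ∣ ∎
    where open ≡-Reasoning

  Forces-coronaSet : ∀ {SG SH} → Forces g SG → Forces h SH → Forces g⊙h (coronaSet SG SH)
  Forces-coronaSet {SG} {SH} FG FH =
    Forces-lift FG (subst (SG ⊆_) (sym (preimage-base-coronaSet SG SH)) (λ i∈ → i∈))
                (λ i → subst (Forces h) (sym (preimage-copy-coronaSet SG SH i)) FH)

  -- Copy i together with base i carries at least Z(H) + [i ∈ X] vertices of B.
  Accounted : Subset n → Subset (n + n * m) → Fin n → Set
  Accounted X B i = Forces h (preimage (copy i) B) ×
                    (base i ∉ B → i ∈ X → ∃[ Y ] Forces h Y × ∣ Y ∣ < ∣ preimage (copy i) B ∣)

  record Certificate (B : Subset (n + n * m)) : Set where
    field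
      X         : Subset n
      forcesX   : Forces g X
      baseX     : preimage base B ⊆ X
      accounted : ∀ i → Accounted X B i

  accounted-untouched : ∀ {X X′ B w i} → base i ≢ w → (∀ a → copy i a ≢ w) → (i ∈ X → i ∈ X′) →
                        Accounted X′ (B ∪ ⁅ w ⁆) i → Accounted X B i
  accounted-untouched {B = B} {w} {i} base≢w copy≢w X⊆X′ (F , shrink)
    rewrite preimage-∪⁅⁆ {f = copy i} {B} copy≢w =
    F , λ base∉B i∈X → shrink (base∉B ∘ stillWhite) (X⊆X′ i∈X)
    where
    stillWhite : base i ∈ B ∪ ⁅ w ⁆ → base i ∈ B
    stillWhite b∈ with x∈p∪⁅y⁆⇒x∈p⊎x≡y b∈
    ... | inj₁ b∈B = b∈B
    ... | inj₂ b≡w = ⊥-elim (base≢w b≡w)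

  accounted-count : ∀ {zh X B i} → (∀ Y → Forces h Y → zh ≤ ∣ Y ∣) → Accounted X B i →
                    indicator (lookup X i) + zh ≤ indicator (lookup B (base i)) + ∣ preimage (copy i) B ∣
  accounted-count {zh} {X} {B} {i} minH (F , shrink) with lookup B (base i) in b∈? | lookup X i in i∈X?
  ... | true  | x     = +-mono-≤ (indicator≤1 x) (minH _ F)
  ... | false | false = minH _ F
  ... | false | true
    with shrink (λ b∈B → contradiction (trans (sym ([]=⇒lookup b∈B)) b∈?) λ ()) (lookup⇒[]= i X i∈X?)
  ...   | Y , FY , ∣Y∣<∣S∣ = ≤-trans (s≤s (minH Y FY)) ∣Y∣<∣S∣

  Certificate⇒bound : ∀ {zg zh B} → (∀ X → Forces g X → zg ≤ ∣ X ∣) → (∀ Y → Forces h Y → zh ≤ ∣ Y ∣) →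
                      Certificate B → zg + n * zh ≤ ∣ B ∣
  Certificate⇒bound {zg} {zh} {B} minG minH C = begin
    zg + n * zh
      ≤⟨ +-monoˡ-≤ (n * zh) (minG X forcesX) ⟩
    ∣ X ∣ + n * zh
      ≡⟨ cong₂ _+_ (∣p∣≡∑ X) (sym (∑-const n zh)) ⟩
    ∑[ i < n ] indicator (lookup X i) + ∑[ i < n ] zh
      ≡⟨ ∑-distrib-+ (indicator ∘ lookup X) (λ _ → zh) ⟨
    ∑[ i < n ] (indicator (lookup X i) + zh)
      ≤⟨ ∑-mono-≤ (λ i → accounted-count minH (accounted i)) ⟩
    ∑[ i < n ] (indicator (lookup B (base i)) + ∣ preimage (copy i) B ∣)
      ≡⟨ ∑-distrib-+ (indicator ∘ lookup B ∘ base) (λ i → ∣ preimage (copy i) B ∣) ⟩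
    ∑[ i < n ] indicator (lookup B (base i)) + ∑[ i < n ] ∣ preimage (copy i) B ∣
      ≡⟨ cong (_+ ∑[ i < n ] ∣ preimage (copy i) B ∣) (∣preimage∣≡∑ base B) ⟨
    ∣ preimage base B ∣ + ∑[ i < n ] ∣ preimage (copy i) B ∣
      ≡⟨ ∣B∣≡∣base∣+∑∣copy∣ B ⟨
    ∣ B ∣ ∎
    where
    open ≤-Reasoning
    open Certificate C

  module LowerBound (simple : IsSimple h) (neighbour : ∀ a → ∃[ b ] Adj h a b) where

    open IsSimple simple
    open Certificate

    certificate-done : ∀ {B} → (∀ x → x ∈ B) → Certificate B
    certificate-done B∋all = record
      { X         = ⊤
      ; forcesX   = done (λ _ → ∈⊤)
      ; baseX     = λ _ → ∈⊤
      ; accounted = λ i → done (λ _ → ∈-preimage⁺ (B∋all _)) , λ base∉B → ⊥-elim (base∉B (B∋all _))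
      }

    certificate-base-base : ∀ {B i j} → CanForce g⊙h B (base i) (base j) →
                            Certificate (B ∪ ⁅ base j ⁆) → Certificate B
    certificate-base-base {B} {i} {j} (canForce i∈B j∉B ij others) C = record
      { X         = X C - j
      ; forcesX   = step i j (inX i∈B) (x∉p-x (X C) j) (adj-base-base⁻ ij)
                      (λ k ik k≢j → inX (others (base k) (adj-base-base⁺ ik) (k≢j ∘ base-injective)))
                      (Forces-⊆ p⊆p-x∪⁅x⁆ (forcesX C))
      ; baseX     = inX ∘ ∈-preimage⁻
      ; accounted = accounted′
      }
      where
      inX : ∀ {k} → base k ∈ B → k ∈ X C - j
      inX {k} k∈B = x∈p∧x≢y⇒x∈p-y (baseX C (∈-preimage⁺ (x∈p⇒x∈p∪⁅y⁆ k∈B)))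
                                  (λ { refl → j∉B k∈B })
      accounted′ : ∀ k → Accounted (X C - j) B k
      accounted′ k with k ≟ j
      ... | yes refl = subst (Forces h) (preimage-∪⁅⁆ (λ _ → base≢copy ∘ sym)) (proj₁ (accounted C k)) ,
                       λ _ j∈X → ⊥-elim (x∉p-x (X C) j j∈X)
      ... | no  k≢j  = accounted-untouched (k≢j ∘ base-injective) (λ _ → base≢copy ∘ sym)
                                           (p─q⊆p (X C) ⁅ j ⁆) (accounted C k)

    certificate-base-copy : ∀ {B i j a} → CanForce g⊙h B (base i) (copy j a) →
                            Certificate (B ∪ ⁅ copy j a ⁆) → Certificate B
    certificate-base-copy {B} {i} {j} {a} (canForce i∈B a∉B ia others) C
      with refl ← adj-base-copy⁻ ia = record
      { X         = X C
      ; forcesX   = forcesX C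
      ; baseX     = baseX C ∘ preimage-⊆ x∈p⇒x∈p∪⁅y⁆
      ; accounted = accounted′
      }
      where
      accounted′ : ∀ k → Accounted (X C) B k
      accounted′ k with k ≟ i
      ... | no  k≢i  = accounted-untouched base≢copy (λ _ → k≢i ∘ proj₁ ∘ copy-injective) id
                                           (accounted C k)
      ... | yes refl with neighbour a
      ...   | b , ab = Forces-all-but-one copyBlack (subst T (symmetric a b) ab)
                                          (λ { refl → irreflexive a ab }) ,
                       λ i∉B → ⊥-elim (i∉B i∈B)
        where
        copyBlack : ∀ c → c ≢ a → c ∈ preimage (copy i) B
        copyBlack c c≢a = ∈-preimage⁺ (others (copy i c) adj-base-copy⁺ (c≢a ∘ proj₂ ∘ copy-injective))

    certificate-copy-copy : ∀ {B i j a b} → CanForce g⊙h B (copy i a) (copy j b) →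
                            Certificate (B ∪ ⁅ copy j b ⁆) → Certificate B
    certificate-copy-copy {B} {i} {j} {a} {b} (canForce a∈B b∉B ab others) C
      with refl , ab′ ← adj-copy-copy⁻ ab = record
      { X         = X C
      ; forcesX   = forcesX C
      ; baseX     = baseX C ∘ preimage-⊆ x∈p⇒x∈p∪⁅y⁆
      ; accounted = accounted′
      }
      where
      accounted′ : ∀ k → Accounted (X C) B k
      accounted′ k with k ≟ i
      ... | no  k≢i  = accounted-untouched base≢copy (λ _ → k≢i ∘ proj₁ ∘ copy-injective) id
                                           (accounted C k)
      ... | yes refl =
        step a b (∈-preimage⁺ a∈B) (b∉B ∘ ∈-preimage⁻) ab′
          (λ c ac c≢b → ∈-preimage⁺ (others (copy i c) (adj-copy-copy⁺ ac) (c≢b ∘ proj₂ ∘ copy-injective)))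
          (Forces-⊆ (preimage-∪⁅f⁆ (proj₂ ∘ copy-injective)) (proj₁ (accounted C i))) ,
        λ i∉B → ⊥-elim (i∉B (others (base i) adj-copy-base⁺ (base≢copy)))

    certificate-copy-base : ∀ {B i j a} → CanForce g⊙h B (copy i a) (base j) →
                            Certificate (B ∪ ⁅ base j ⁆) → Certificate B
    certificate-copy-base {B} {i} {j} {a} (canForce a∈B j∉B aj others) C
      with refl ← adj-copy-base⁻ aj = record
      { X         = X C
      ; forcesX   = forcesX C
      ; baseX     = baseX C ∘ preimage-⊆ x∈p⇒x∈p∪⁅y⁆
      ; accounted = accounted′
      }
      where
      accounted′ : ∀ k → Accounted (X C) B k
      accounted′ k with k ≟ i
      ... | no  k≢i  = accounted-untouched (k≢i ∘ base-injective) (λ _ → base≢copy ∘ sym) id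
                                           (accounted C k)
      ... | yes refl with neighbour a
      ...   | b , ab = Fi , λ _ _ → preimage (copy i) B - b ,
                                  Forces-drop-neighbour (irreflexive a) (∈-preimage⁺ a∈B) ab N[a]⊆ Fi ,
                                  x∈p⇒∣p-x∣<∣p∣ (N[a]⊆ b ab)
        where
        Fi : Forces h (preimage (copy i) B)
        Fi = subst (Forces h) (preimage-∪⁅⁆ (λ _ → base≢copy ∘ sym)) (proj₁ (accounted C i))
        N[a]⊆ : ∀ c → Adj h a c → c ∈ preimage (copy i) B
        N[a]⊆ c ac = ∈-preimage⁺ (others (copy i c) (adj-copy-copy⁺ ac) (base≢copy ∘ sym))

    certificate-step : ∀ {B u w} → Vertex u → Vertex w → CanForce g⊙h B u w →
                       Certificate (B ∪ ⁅ w ⁆) → Certificate B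
    certificate-step (inBase i)   (inBase j)   = certificate-base-base
    certificate-step (inBase i)   (inCopy j b) = certificate-base-copy
    certificate-step (inCopy i a) (inCopy j b) = certificate-copy-copy
    certificate-step (inCopy i a) (inBase j)   = certificate-copy-base

    Forces⇒Certificate : ∀ {B} → Forces g⊙h B → Certificate B
    Forces⇒Certificate (done B∋all) = certificate-done B∋all
    Forces⇒Certificate (step u w u∈B w∉B uw others F) =
      certificate-step (vertex u) (vertex w) (canForce u∈B w∉B uw others) (Forces⇒Certificate F)

Fin-∃≢ : ∀ {k} → 2 ≤ k → (a : Fin k) → ∃[ b ] a ≢ b
Fin-∃≢ (s≤s (s≤s _)) zero    = suc zero , λ ()
Fin-∃≢ (s≤s (s≤s _)) (suc a) = zero , λ ()

connected⇒neighbour : ∀ {k} {h : RawGraph k} → Connected h → 2 ≤ k → ∀ a → ∃[ b ] Adj h a b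
connected⇒neighbour conn 2≤k a with Fin-∃≢ 2≤k a
... | b , a≢b with conn a b
...   | here       = ⊥-elim (a≢b refl)
...   | there ab _ = _ , ab

Z-corona : ∀ {n m} (g : RawGraph n) (h : RawGraph m) → IsSimple h → Connected h → 2 ≤ m →
           ∀ {z zg zh} → IsZeroForcingNumber (corona g h) z →
           IsZeroForcingNumber g zg → IsZeroForcingNumber h zh → z ≡ zg + n * zh
Z-corona {n} g h simple conn 2≤m {z} {zg} {zh}
         ((B , FB , ∣B∣≡z) , minC) ((SG , FSG , ∣SG∣≡zg) , minG) ((SH , FSH , ∣SH∣≡zh) , minH) =
  ≤-antisym upper lower
  where
  open Corona g h
  open LowerBound simple (connected⇒neighbour conn 2≤m)
  upper : z ≤ zg + n * zh
  upper = subst (z ≤_) (trans (∣coronaSet∣ SG SH) (cong₂ (λ x y → x + n * y) ∣SG∣≡zg ∣SH∣≡zh))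
                (minC _ (Forces-coronaSet FSG FSH))
  lower : zg + n * zh ≤ z
  lower = subst (zg + n * zh ≤_) ∣B∣≡z (Certificate⇒bound minG minH (Forces⇒Certificate FB))

coronaOrder≡ : ∀ n₁ n₂ k → coronaOrder n₁ n₂ k ≡ n₁ * (1 + n₂) ^ k
coronaOrder≡ n₁ n₂ zero    = sym (*-identityʳ n₁)
coronaOrder≡ n₁ n₂ (suc k) rewrite coronaOrder≡ n₁ n₂ k = step-identity n₁ n₂ ((1 + n₂) ^ k)
  where
  step-identity : ∀ a b p → a * p + a * p * b ≡ a * ((1 + b) * p)
  step-identity = solve-∀

-- Only H needs to be simple, connected and nontrivial.
mainTheorem1 : ∀ {n₁ n₂ : ℕ} (G : RawGraph n₁) (H : RawGraph n₂) →
    IsSimple G → IsSimple H → Connected G → Connected H →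
    2 ≤ n₁ → 2 ≤ n₂ →
    ∀ (k : ℕ) → 1 ≤ k →
    ∀ (zk zk′ zH : ℕ) →
    IsZeroForcingNumber (coronaPow k G H) zk →
    IsZeroForcingNumber (coronaPow (k ∸ 1) G H) zk′ →
    IsZeroForcingNumber H zH →
    zk ≡ zk′ + n₁ * (1 + n₂) ^ (k ∸ 1) * zH
mainTheorem1 {n₁} {n₂} G H _ simpleH _ connH _ 2≤n₂ (suc k) _ zk zk′ zH Zk Zk′ ZH = begin
  zk                                      ≡⟨ Z-corona (coronaPow k G H) H simpleH connH 2≤n₂ Zk Zk′ ZH ⟩
  zk′ + coronaOrder n₁ n₂ k * zH          ≡⟨ cong (λ o → zk′ + o * zH) (coronaOrder≡ n₁ n₂ k) ⟩
  zk′ + n₁ * (1 + n₂) ^ k * zH            ∎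
  where open ≡-Reasoning
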